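{- Let $G$ be a digraph (or graph). For $j=1,2$ let $P_j$ be a dapasting of dacards $(A_j,\mathrm{dt}(A_j))$ and $(B_j,\mathrm{dt}(B_j))$ of $G$ as members of $\mathrm{Dadeck}(G)$. If $P_1$ and $P_2$ are isomorphic (by a label-preserving isomorphism), then the multisets $\{(A_1,\mathrm{dt}(A_1)),(B_1,\mathrm{dt}(B_1))\}$ and $\{(A_2,\mathrm{dt}(A_2)),(B_2,\mathrm{dt}(B_2))\}$ of dacards are the same (up to identity of dacards). The corresponding statement holds for isomorphic pastings of cards of graphs/digraphs: if $P_j$ is a pasting of cards $A_j,B_j$ of $G$ as members of $\mathrm{Deck}(G)$ for $j=1,2$ and $P_1\cong P_2$ by an isomorphism preserving labels, then $\{A_1,B_1\}=\{A_2,B_2\}$ as multisets of isomorphism classes.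
   Context: Digraphs are finite, without loops or multiple arcs; a graph is regarded as a digraph in which every edge is a pair of opposite arcs. For a vertex $x$ of a digraph $D$, $\mathrm{dt}_D(x)=(a,b,c)$ where $a,b,c$ count vertices $w$ such that respectively only $xw$, only $wx$, both $xw,wx$ are arcs. Cards are isomorphism classes of $D-x$; dacards are pairs $(D-x,\mathrm{dt}_D(x))$, two dacards being identical if their digraphs are isomorphic and triples equal. Deck/Dadeck are the multisets of cards/dacards; equal deck (dadeck) means hypomorphs (da-hypomorphs). A dapasting of dacards $(A,\alpha),(B,\beta)$ of $G$ (from distinct vertices) as members of $\mathrm{Dadeck}(G)$ is a digraph $P$ with distinct non-adjacent vertices $u,v$ labeled $(e,\alpha)$, $(e,\beta)$ (others unlabeled), with $P-u\cong A$, $P-v\cong B$, such that some $Y\in\{P,P+uv,P+vu,P+uv+vu\}$ has $\mathrm{dt}_Y(u)=\alpha$, $\mathrm{dt}_Y(v)=\beta$ and is da-hypomorphic to $G$. A pasting of cards $A\cong G-v_1$, $B\cong G-v_2$ ($v_1\neq v_2$) as members of $\mathrm{Deck}(G)$ is a digraph $P$ with distinct non-adjacent vertices $u,v$ both labeled $e$, with $P-u\cong A$, $P-v\cong B$, such that some $Y\in\{P,P+uv,P+vu,P+uv+vu\}$ (for graphs $\{P,P+uv\}$) is hypomorphic to $G$. -}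

module Defs where

open import Data.Nat using (ℕ; zero; suc; _+_)
open import Data.Bool using (Bool; true; false; _∧_; _∨_; not; if_then_else_)
open import Data.Bool.Properties using (∨-identityˡ; ∧-zeroʳ)
open import Data.Fin using (Fin; zero; suc; punchIn; _≟_)
open import Data.Maybe using (Maybe; just; nothing)
open import Data.Product using (Σ; _×_; _,_; ∃; ∃-syntax)
open import Relation.Nullary using (¬_; does; yes; no)
open import Relation.Nullary.Decidable using (dec-false)
open import Relation.Binary.PropositionalEquality using (_≡_; _≢_; refl; cong)
open import Function.Bundles using (_↔_; Inverse)

record Digraph (n : ℕ) : Set where
  field
    adj    : Fin n → Fin n → Bool
    irrefl : ∀ i → adj i i ≡ false
open Digraph public

IsGraph : ∀ {n} → Digraph n → Set
IsGraph D = ∀ i j → adj D i j ≡ adj D j i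

-- Isomorphism of digraphs (card = isomorphism class of D - x).
_≅_ : ∀ {m n} → Digraph m → Digraph n → Set
_≅_ {m} {n} D E =
  Σ (Fin m ↔ Fin n) λ f →
    ∀ i j → adj D i j ≡ adj E (Inverse.to f i) (Inverse.to f j)

_─_ : ∀ {n} → Digraph (suc n) → Fin (suc n) → Digraph n
D ─ x = record
  { adj    = λ i j → adj D (punchIn x i) (punchIn x j)
  ; irrefl = λ i → irrefl D (punchIn x i) }

-- Adding arcs: addArcs P u v b₁ b₂ adds uv if b₁ and vu if b₂.
-- (b₁,b₂) ranges over the four digraphs P, P+uv, P+vu, P+uv+vu.
private
  lemma-no-loop : ∀ {n} (u v i : Fin n) → u ≢ v →
    (does (i ≟ u) ∧ does (i ≟ v)) ≡ false
  lemma-no-loop u v i u≢v with i ≟ u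
  ... | no _ = refl
  ... | yes refl with u ≟ v
  ...   | yes u≡v = Data.Empty.⊥-elim (u≢v u≡v)
    where import Data.Empty
  ...   | no _ = refl

addArcs : ∀ {n} → Digraph n → (u v : Fin n) → u ≢ v → Bool → Bool → Digraph n
addArcs P u v u≢v b₁ b₂ = record
  { adj    = λ i j → adj P i j
                   ∨ (b₁ ∧ (does (i ≟ u) ∧ does (j ≟ v)))
                   ∨ (b₂ ∧ (does (i ≟ v) ∧ does (j ≟ u)))
  ; irrefl = λ i → prf i }
  where
  prf : ∀ i → (adj P i i ∨ (b₁ ∧ (does (i ≟ u) ∧ does (i ≟ v)))
                        ∨ (b₂ ∧ (does (i ≟ v) ∧ does (i ≟ u)))) ≡ false
  prf i rewrite irrefl P i
              | lemma-no-loop u v i u≢v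
              | lemma-no-loop v u i (λ e → u≢v (Relation.Binary.PropositionalEquality.sym e))
              | ∧-zeroʳ b₁ | ∧-zeroʳ b₂ = refl

count : ∀ {n} → (Fin n → Bool) → ℕ
count {zero}  p = 0
count {suc n} p = (if p zero then 1 else 0) + count (λ i → p (suc i))

Triple : Set
Triple = ℕ × ℕ × ℕ

dt : ∀ {n} → Digraph n → Fin n → Triple
dt D x =
  count (λ w → adj D x w ∧ not (adj D w x)) ,
  count (λ w → not (adj D x w) ∧ adj D w x) ,
  count (λ w → adj D x w ∧ adj D w x)

-- Equal decks / dadecks (multiset equality via a bijection of vertices).

Hypomorphic : ∀ {n} → Digraph (suc n) → Digraph (suc n) → Set
Hypomorphic {n} D E =
  Σ (Fin (suc n) ↔ Fin (suc n)) λ σ → ∀ x → (D ─ x) ≅ (E ─ Inverse.to σ x)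

DaHypomorphic : ∀ {n} → Digraph (suc n) → Digraph (suc n) → Set
DaHypomorphic {n} D E =
  Σ (Fin (suc n) ↔ Fin (suc n)) λ σ → ∀ x →
    ((D ─ x) ≅ (E ─ Inverse.to σ x)) × (dt D x ≡ dt E (Inverse.to σ x))

-- Dapasting of dacards (A , α), (B , β) of G as members of Dadeck(G).
-- The labels: u carries (e , α), v carries (e , β), others unlabeled.

record Dapasting {k : ℕ} (G : Digraph (suc k))
                 (A : Digraph k) (α : Triple) (B : Digraph k) (β : Triple) : Set where
  field
    x₁ x₂   : Fin (suc k)
    x₁≢x₂   : x₁ ≢ x₂
    A-card  : A ≅ (G ─ x₁)
    α-dt    : α ≡ dt G x₁
    B-card  : B ≅ (G ─ x₂)
    β-dt    : β ≡ dt G x₂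
    P       : Digraph (suc k)
    u v     : Fin (suc k)
    u≢v     : u ≢ v
    nonadj₁ : adj P u v ≡ false
    nonadj₂ : adj P v u ≡ false
    P-u     : (P ─ u) ≅ A
    P-v     : (P ─ v) ≅ B
    b₁ b₂   : Bool
    Y-dt-u  : dt (addArcs P u v u≢v b₁ b₂) u ≡ α
    Y-dt-v  : dt (addArcs P u v u≢v b₁ b₂) v ≡ β
    Y-hypo  : DaHypomorphic (addArcs P u v u≢v b₁ b₂) G

  label : Fin (suc k) → Maybe Triple
  label w = if does (w ≟ u) then just α else (if does (w ≟ v) then just β else nothing)

record Pasting {k : ℕ} (G : Digraph (suc k)) (A B : Digraph k) : Set where
  field
    x₁ x₂   : Fin (suc k)
    x₁≢x₂   : x₁ ≢ x₂
    A-card  : A ≅ (G ─ x₁)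
    B-card  : B ≅ (G ─ x₂)
    P       : Digraph (suc k)
    u v     : Fin (suc k)
    u≢v     : u ≢ v
    nonadj₁ : adj P u v ≡ false
    nonadj₂ : adj P v u ≡ false
    P-u     : (P ─ u) ≅ A
    P-v     : (P ─ v) ≅ B
    b₁ b₂   : Bool
    Y-hypo  : Hypomorphic (addArcs P u v u≢v b₁ b₂) G

  label : Fin (suc k) → Bool
  label w = does (w ≟ u) ∨ does (w ≟ v)

-- Pasting of cards of a graph G: P is a graph and Y ∈ {P, P+uv}
-- (adding the edge uv = both arcs uv and vu).
record GPasting {k : ℕ} (G : Digraph (suc k)) (A B : Digraph k) : Set where
  field
    x₁ x₂   : Fin (suc k)
    x₁≢x₂   : x₁ ≢ x₂
    A-card  : A ≅ (G ─ x₁)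
    B-card  : B ≅ (G ─ x₂)
    P       : Digraph (suc k)
    P-graph : IsGraph P
    u v     : Fin (suc k)
    u≢v     : u ≢ v
    nonadj  : adj P u v ≡ false
    P-u     : (P ─ u) ≅ A
    P-v     : (P ─ v) ≅ B
    b       : Bool
    Y-hypo  : Hypomorphic (addArcs P u v u≢v b b) G

  label : Fin (suc k) → Bool
  label w = does (w ≟ u) ∨ does (w ≟ v)

DapIso : ∀ {k} {G : Digraph (suc k)} {A₁ B₁ A₂ B₂ : Digraph k} {α₁ β₁ α₂ β₂ : Triple} →
  Dapasting G A₁ α₁ B₁ β₁ → Dapasting G A₂ α₂ B₂ β₂ → Set
DapIso {k} P₁ P₂ =
  Σ (Fin (suc k) ↔ Fin (suc k)) λ f →
    (∀ i j → adj (Dapasting.P P₁) i j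
           ≡ adj (Dapasting.P P₂) (Inverse.to f i) (Inverse.to f j))
    × (∀ w → Dapasting.label P₁ w ≡ Dapasting.label P₂ (Inverse.to f w))

PasIso : ∀ {k} {G : Digraph (suc k)} {A₁ B₁ A₂ B₂ : Digraph k} →
  Pasting G A₁ B₁ → Pasting G A₂ B₂ → Set
PasIso {k} P₁ P₂ =
  Σ (Fin (suc k) ↔ Fin (suc k)) λ f →
    (∀ i j → adj (Pasting.P P₁) i j
           ≡ adj (Pasting.P P₂) (Inverse.to f i) (Inverse.to f j))
    × (∀ w → Pasting.label P₁ w ≡ Pasting.label P₂ (Inverse.to f w))

GPasIso : ∀ {k} {G : Digraph (suc k)} {A₁ B₁ A₂ B₂ : Digraph k} →
  GPasting G A₁ B₁ → GPasting G A₂ B₂ → Set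
GPasIso {k} P₁ P₂ =
  Σ (Fin (suc k) ↔ Fin (suc k)) λ f →
    (∀ i j → adj (GPasting.P P₁) i j
           ≡ adj (GPasting.P P₂) (Inverse.to f i) (Inverse.to f j))
    × (∀ w → GPasting.label P₁ w ≡ GPasting.label P₂ (Inverse.to f w))

SameDacard : ∀ {k} → Digraph k → Triple → Digraph k → Triple → Set
SameDacard A α B β = (A ≅ B) × (α ≡ β)

SameDacardPair : ∀ {k} → Digraph k → Triple → Digraph k → Triple →
                         Digraph k → Triple → Digraph k → Triple → Set
SameDacardPair A₁ α₁ B₁ β₁ A₂ α₂ B₂ β₂ =
  (SameDacard A₁ α₁ A₂ α₂ × SameDacard B₁ β₁ B₂ β₂)
  ⊎ (SameDacard A₁ α₁ B₂ β₂ × SameDacard B₁ β₁ A₂ α₂)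
  where open import Data.Sum using (_⊎_)

SameCardPair : ∀ {k} → Digraph k → Digraph k → Digraph k → Digraph k → Set
SameCardPair A₁ B₁ A₂ B₂ =
  ((A₁ ≅ A₂) × (B₁ ≅ B₂)) ⊎ ((A₁ ≅ B₂) × (B₁ ≅ A₂))
  where open import Data.Sum using (_⊎_)

{-# OPTIONS --safe #-}
module Submission where

-- A label-preserving isomorphism f : P₁ ≅ P₂ maps the two labelled vertices {u₁, v₁} of P₁
-- bijectively onto {u₂, v₂}, either keeping or swapping them, and deleting a vertex commutes
-- with f, so P₁ - u₁ ≅ P₂ - f u₁ and P₁ - v₁ ≅ P₂ - f v₁; the labels carry the degree
-- triples along. Nothing else about the pastings (in particular nothing about G) is used.

open import Defs
open import Data.Nat using (ℕ; suc)
open import Data.Bool using (Bool; T; _∨_)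
open import Data.Bool.Properties using (T-∨; T-≡)
open import Data.Empty using (⊥-elim)
open import Data.Fin using (Fin; _≟_)
open import Data.Fin.Permutation using (remove; punchIn-permute)
open import Data.Maybe using (just)
open import Data.Maybe.Properties using (just-injective)
open import Data.Product using (_×_; _,_; proj₁)
open import Data.Sum using (_⊎_; inj₁; inj₂)
import Data.Sum as Sum
open import Function.Base using (_∘_)
open import Function.Bundles using (_↔_; Inverse; Injection; Equivalence)
open import Function.Construct.Composition using (_↔-∘_)
open import Function.Construct.Symmetry using (↔-sym)
open import Function.Definitions using (Injective)
open import Function.Properties.Inverse using (↔⇒↣)
open import Relation.Nullary using (Dec; yes; no; does)
open import Relation.Nullary.Decidable using (dec-true; dec-false)
open import Relation.Binary.PropositionalEquality

≅-sym : ∀ {m n} {D : Digraph m} {E : Digraph n} → D ≅ E → E ≅ D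
≅-sym {E = E} (f , pres) = ↔-sym f , λ i j →
  sym (trans (pres _ _) (cong₂ (adj E) (Inverse.strictlyInverseˡ f i) (Inverse.strictlyInverseˡ f j)))

≅-trans : ∀ {m n p} {D : Digraph m} {E : Digraph n} {F : Digraph p} → D ≅ E → E ≅ F → D ≅ F
≅-trans (f , pres) (g , pres′) = g ↔-∘ f , λ i j → trans (pres i j) (pres′ _ _)

─-resp-≅ : ∀ {m n} {D : Digraph (suc m)} {E : Digraph (suc n)} (iso : D ≅ E) (x : Fin (suc m)) →
  (D ─ x) ≅ (E ─ Inverse.to (proj₁ iso) x)
─-resp-≅ {E = E} (f , pres) x = remove x f , λ i j →
  trans (pres _ _) (cong₂ (adj E) (punchIn-permute f x i) (punchIn-permute f x j))

cards-≅ : ∀ {k} {Q₁ Q₂ : Digraph (suc k)} {A B : Digraph k} {x y : Fin (suc k)}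
  (iso : Q₁ ≅ Q₂) → Inverse.to (proj₁ iso) x ≡ y → (Q₁ ─ x) ≅ A → (Q₂ ─ y) ≅ B → A ≅ B
cards-≅ {Q₁ = Q₁} {Q₂} {A} {B} {x} iso refl Q₁-x≅A Q₂-y≅B =
  ≅-trans {D = A} {E = Q₁ ─ x} {F = B} (≅-sym {D = Q₁ ─ x} {E = A} Q₁-x≅A)
    (≅-trans {D = Q₁ ─ x} {E = Q₂ ─ Inverse.to (proj₁ iso) x} {F = B}
      (─-resp-≅ {D = Q₁} {E = Q₂} iso x) Q₂-y≅B)

pair-image : ∀ {A B : Set} {f : A → B} → Injective _≡_ _≡_ f →
  ∀ {u₁ v₁ u₂ v₂} → u₁ ≢ v₁ → f u₁ ≡ u₂ ⊎ f u₁ ≡ v₂ → f v₁ ≡ u₂ ⊎ f v₁ ≡ v₂ →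
  (f u₁ ≡ u₂ × f v₁ ≡ v₂) ⊎ (f u₁ ≡ v₂ × f v₁ ≡ u₂)
pair-image inj u₁≢v₁ (inj₁ p) (inj₁ q) = ⊥-elim (u₁≢v₁ (inj (trans p (sym q))))
pair-image inj u₁≢v₁ (inj₁ p) (inj₂ q) = inj₁ (p , q)
pair-image inj u₁≢v₁ (inj₂ p) (inj₁ q) = inj₂ (p , q)
pair-image inj u₁≢v₁ (inj₂ p) (inj₂ q) = ⊥-elim (u₁≢v₁ (inj (trans p (sym q))))

↔-injective : ∀ {A B : Set} (f : A ↔ B) → Injective _≡_ _≡_ (Inverse.to f)
↔-injective f = Injection.injective (↔⇒↣ f)

does⇒ : ∀ {A : Set} (a? : Dec A) → T (does a?) → A
does⇒ (yes a) _ = a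

marked⇒ : ∀ {n} {u v w : Fin n} → T (does (w ≟ u) ∨ does (w ≟ v)) → w ≡ u ⊎ w ≡ v
marked⇒ {u = u} {v} {w} = Sum.map (does⇒ (w ≟ u)) (does⇒ (w ≟ v)) ∘ Equivalence.to T-∨

⇒marked : ∀ {n} {u v w : Fin n} → w ≡ u ⊎ w ≡ v → T (does (w ≟ u) ∨ does (w ≟ v))
⇒marked {u = u} {v} {w} = Equivalence.from T-∨ ∘ Sum.map (does⇐ (w ≟ u)) (does⇐ (w ≟ v))
  where
  does⇐ : ∀ {A : Set} (a? : Dec A) → A → T (does a?)
  does⇐ a? a = Equivalence.from T-≡ (dec-true a? a)

record CardPasting {k : ℕ} (A B : Digraph k) : Set where
  field
    P   : Digraph (suc k)
    u v : Fin (suc k)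
    u≢v : u ≢ v
    P-u : (P ─ u) ≅ A
    P-v : (P ─ v) ≅ B

  marked : Fin (suc k) → Bool
  marked w = does (w ≟ u) ∨ does (w ≟ v)

pasting⇒cardPasting : ∀ {k} {G : Digraph (suc k)} {A B : Digraph k} → Pasting G A B → CardPasting A B
pasting⇒cardPasting p = record { Pasting p }

gPasting⇒cardPasting : ∀ {k} {G : Digraph (suc k)} {A B : Digraph k} → GPasting G A B → CardPasting A B
gPasting⇒cardPasting p = record { GPasting p }

module _ {k} {A₁ B₁ A₂ B₂ : Digraph k} (C₁ : CardPasting A₁ B₁) (C₂ : CardPasting A₂ B₂) where
  private
    module C₁ = CardPasting C₁
    module C₂ = CardPasting C₂

  markedIso⇒sameCardPair : (iso : C₁.P ≅ C₂.P) →
    (∀ w → C₁.marked w ≡ C₂.marked (Inverse.to (proj₁ iso) w)) → SameCardPair A₁ B₁ A₂ B₂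
  markedIso⇒sameCardPair iso@(f , _) keeps-marks =
    matched (pair-image (↔-injective f) C₁.u≢v (marked-image (inj₁ refl)) (marked-image (inj₂ refl)))
    where
    to = Inverse.to f

    marked-image : ∀ {w} → w ≡ C₁.u ⊎ w ≡ C₁.v → to w ≡ C₂.u ⊎ to w ≡ C₂.v
    marked-image {w} = marked⇒ ∘ subst T (keeps-marks w) ∘ ⇒marked

    card : ∀ {x y} (A B : Digraph k) → to x ≡ y → (C₁.P ─ x) ≅ A → (C₂.P ─ y) ≅ B → A ≅ B
    card A B = cards-≅ {Q₁ = C₁.P} {Q₂ = C₂.P} {A} {B} iso

    matched : (to C₁.u ≡ C₂.u × to C₁.v ≡ C₂.v) ⊎ (to C₁.u ≡ C₂.v × to C₁.v ≡ C₂.u) →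
      SameCardPair A₁ B₁ A₂ B₂
    matched (inj₁ (u↦u , v↦v)) = inj₁ (card A₁ A₂ u↦u C₁.P-u C₂.P-u , card B₁ B₂ v↦v C₁.P-v C₂.P-v)
    matched (inj₂ (u↦v , v↦u)) = inj₂ (card A₁ B₂ u↦v C₁.P-u C₂.P-v , card B₁ A₂ v↦u C₁.P-v C₂.P-u)

module DapastingLabels {k} {G : Digraph (suc k)} {A B : Digraph k} {α β : Triple}
                       (p : Dapasting G A α B β) where
  open Dapasting p

  label-u : label u ≡ just α
  label-u rewrite dec-true (u ≟ u) refl = refl

  label-v : label v ≡ just β
  label-v rewrite dec-false (v ≟ u) (u≢v ∘ sym) | dec-true (v ≟ v) refl = refl

  label≡just⇒ : ∀ {w t} → label w ≡ just t → w ≡ u ⊎ w ≡ v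
  label≡just⇒ {w} _ with w ≟ u
  ... | yes w≡u = inj₁ w≡u
  ... | no _ with w ≟ v
  ...   | yes w≡v = inj₂ w≡v
  label≡just⇒ () | no _ | no _

dapastingIso⇒sameDacardPair :
  ∀ {k} {G : Digraph (suc k)} {A₁ B₁ A₂ B₂ : Digraph k} {α₁ β₁ α₂ β₂ : Triple}
  (P₁ : Dapasting G A₁ α₁ B₁ β₁) (P₂ : Dapasting G A₂ α₂ B₂ β₂) →
  DapIso P₁ P₂ → SameDacardPair A₁ α₁ B₁ β₁ A₂ α₂ B₂ β₂
dapastingIso⇒sameDacardPair {k} {A₁ = A₁} {B₁} {A₂} {B₂} {α₁} {β₁} {α₂} {β₂}
                            P₁ P₂ (f , pres , keeps-labels) =
  matched (pair-image (↔-injective f) Q₁.u≢v (label-image L₁.label-u) (label-image L₁.label-v))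
  where
  module Q₁ = Dapasting P₁
  module Q₂ = Dapasting P₂
  module L₁ = DapastingLabels P₁
  module L₂ = DapastingLabels P₂
  to = Inverse.to f

  label-image : ∀ {w t} → Q₁.label w ≡ just t → to w ≡ Q₂.u ⊎ to w ≡ Q₂.v
  label-image {w} ℓ = L₂.label≡just⇒ (trans (sym (keeps-labels w)) ℓ)

  dacard : ∀ {x y t₁ t₂} (A B : Digraph k) → to x ≡ y →
    (Q₁.P ─ x) ≅ A → Q₁.label x ≡ just t₁ → (Q₂.P ─ y) ≅ B → Q₂.label y ≡ just t₂ →
    SameDacard A t₁ B t₂
  dacard {x} A B x↦y Q₁-x≅A ℓ₁ Q₂-y≅B ℓ₂ =
    cards-≅ {Q₁ = Q₁.P} {Q₂ = Q₂.P} {A} {B} (f , pres) x↦y Q₁-x≅A Q₂-y≅B ,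
    just-injective (trans (sym ℓ₁) (trans (keeps-labels x) (trans (cong Q₂.label x↦y) ℓ₂)))

  matched : (to Q₁.u ≡ Q₂.u × to Q₁.v ≡ Q₂.v) ⊎ (to Q₁.u ≡ Q₂.v × to Q₁.v ≡ Q₂.u) →
    SameDacardPair A₁ α₁ B₁ β₁ A₂ α₂ B₂ β₂
  matched (inj₁ (u↦u , v↦v)) = inj₁
    ( dacard A₁ A₂ u↦u Q₁.P-u L₁.label-u Q₂.P-u L₂.label-u
    , dacard B₁ B₂ v↦v Q₁.P-v L₁.label-v Q₂.P-v L₂.label-v )
  matched (inj₂ (u↦v , v↦u)) = inj₂
    ( dacard A₁ B₂ u↦v Q₁.P-u L₁.label-u Q₂.P-v L₂.label-v
    , dacard B₁ A₂ v↦u Q₁.P-v L₁.label-v Q₂.P-u L₂.label-u )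

lemma5p1 :
    (∀ {k} (G : Digraph (suc k)) (A₁ B₁ A₂ B₂ : Digraph k) (α₁ β₁ α₂ β₂ : Triple)
       (P₁ : Dapasting G A₁ α₁ B₁ β₁) (P₂ : Dapasting G A₂ α₂ B₂ β₂) →
       DapIso P₁ P₂ → SameDacardPair A₁ α₁ B₁ β₁ A₂ α₂ B₂ β₂)
    × (∀ {k} (G : Digraph (suc k)) (A₁ B₁ A₂ B₂ : Digraph k)
       (P₁ : Pasting G A₁ B₁) (P₂ : Pasting G A₂ B₂) →
       PasIso P₁ P₂ → SameCardPair A₁ B₁ A₂ B₂)
    × (∀ {k} (G : Digraph (suc k)) → IsGraph G → (A₁ B₁ A₂ B₂ : Digraph k)
       (P₁ : GPasting G A₁ B₁) (P₂ : GPasting G A₂ B₂) →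
       GPasIso P₁ P₂ → SameCardPair A₁ B₁ A₂ B₂)
lemma5p1 =
  (λ _ _ _ _ _ _ _ _ _ → dapastingIso⇒sameDacardPair) ,
  (λ _ _ _ _ _ P₁ P₂ (f , pres , keeps-marks) →
     markedIso⇒sameCardPair (pasting⇒cardPasting P₁) (pasting⇒cardPasting P₂) (f , pres) keeps-marks) ,
  (λ _ _ _ _ _ _ P₁ P₂ (f , pres , keeps-marks) →
     markedIso⇒sameCardPair (gPasting⇒cardPasting P₁) (gPasting⇒cardPasting P₂) (f , pres) keeps-marks)
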